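{- Let $(M,\gamma,r,k)$ be a YES-instance of FDMC. Then there is a solution $M^*$ (a fair $m\times n$ matrix differing from $M$ in at most $k$ entries with at most $r$ distinct rows) such that in the reduced edit graph of $M^*$, every $M$-fair type has no out-edges or has no in-edges.
   Context: An instance of \textsc{Fair Discrete Means Cluster Editing} (FDMC) consists of an $m\times n$ matrix $M$ (over some finite domain), a vector $\gamma\in[c]^m$ (the color of row $i$ is $\gamma[i]$), and positive integers $k$ and $r$. A type is an $n$-dimensional vector; the type of row $t$ of a matrix is that row. A cluster of a matrix is a maximal set of pairwise identical rows. For a color $i\in[c]$ let $|\gamma|_i$ be the number of entries of $\gamma$ equal to $i$. A set $S$ of rows is fair if it contains exactly $\frac{|\gamma|_i}{m}|S|$ rows of color $i$ for every $i\in[c]$; a matrix is fair if all its clusters are fair. The instance is a YES-instance if there exists a fair $m\times n$ matrix $M'$ differing from $M$ in at most $k$ entries with at most $r$ distinct rows. A type $\tau$ is $M$-fair if the set of rows of $M$ of type $\tau$ is empty or fair. For a matrix $M'$, the reduced edit graph of $M'$ is the directed multigraph whose vertices are the types occurring as rows in $M$ or $M'$, with one edge from $M[t,\star]$ to $M'[t,\star]$ (colored $\gamma[t]$, weighted by the Hamming distance) for every row index $t\in[m]$ with $M[t,\star]\neq M'[t,\star]$ (self-loops are omitted). -}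

module Defs where

open import Data.Nat using (ℕ; _*_; _≤_; _+_)
open import Data.Fin using (Fin)
import Data.Fin.Properties as FinP
open import Data.Vec using (Vec; lookup)
import Data.Vec.Properties as VecP
open import Data.List using (List; length; filter; deduplicate; map; allFin)
open import Data.Nat.ListAction using (sum)
import Level
open import Data.Product using (Σ; _×_)
open import Data.Sum using (_⊎_)
open import Relation.Binary.PropositionalEquality using (_≡_; _≢_)
open import Relation.Binary.Definitions using (DecidableEquality)
open import Relation.Nullary using (¬_; ¬?)
open import Relation.Nullary.Decidable using (_×-dec_)
open import Relation.Unary using (Pred; Decidable)

RowType : ℕ → ℕ → Set
RowType d n = Vec (Fin d) n

_≟T_ : ∀ {d n} → DecidableEquality (RowType d n)
_≟T_ = VecP.≡-dec FinP._≟_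

Matrix : ℕ → ℕ → ℕ → Set
Matrix d m n = Fin m → RowType d n

Coloring : ℕ → ℕ → Set
Coloring c m = Fin m → Fin c

count : ∀ {m} {P : Pred (Fin m) Level.zero} → Decidable P → ℕ
count {m} P? = length (filter P? (allFin m))

colorCount : ∀ {c m} → Coloring c m → Fin c → ℕ
colorCount γ i = count (λ t → γ t FinP.≟ i)

-- A set S of rows (given as a decidable predicate) is fair if for every
-- color i it contains exactly (|γ|_i / m) |S| rows of color i;
-- stated multiplicatively:  #(S ∩ color i) * m = |γ|_i * |S|.
Fair : ∀ {c m} → Coloring c m → {S : Pred (Fin m) Level.zero} → Decidable S → Set
Fair {c} {m} γ {S} S? =
  (i : Fin c) → count (λ t → S? t ×-dec (γ t FinP.≟ i)) * m ≡ colorCount γ i * count S?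

-- A matrix is fair if all its clusters (maximal sets of identical rows) are
-- fair; the cluster containing row t is the set of rows equal to row t.
FairMatrix : ∀ {c d m n} → Coloring c m → Matrix d m n → Set
FairMatrix {m = m} γ M' = (t : Fin m) → Fair γ (λ s → M' s ≟T M' t)

hamming : ∀ {d n} → RowType d n → RowType d n → ℕ
hamming {n = n} u v = count (λ j → ¬? (lookup u j FinP.≟ lookup v j))

editDistance : ∀ {d m n} → Matrix d m n → Matrix d m n → ℕ
editDistance {m = m} M M' = sum (map (λ t → hamming (M t) (M' t)) (allFin m))

distinctRows : ∀ {d m n} → Matrix d m n → ℕ
distinctRows {m = m} M = length (deduplicate _≟T_ (map M (allFin m)))

Solution : ∀ {c d m n} → Matrix d m n → Coloring c m → ℕ → ℕ → Matrix d m n → Set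
Solution M γ k r M' = FairMatrix γ M' × editDistance M M' ≤ k × distinctRows M' ≤ r

YesInstance : ∀ {c d m n} → Matrix d m n → Coloring c m → ℕ → ℕ → Set
YesInstance {d = d} {m} {n} M γ k r = Σ (Matrix d m n) (λ M' → Solution M γ k r M')

MFairType : ∀ {c d m n} → Matrix d m n → Coloring c m → RowType d n → Set
MFairType {m = m} M γ τ =
  ((t : Fin m) → M t ≢ τ) ⊎ Fair γ (λ s → M s ≟T τ)

-- Reduced edit graph of M' (w.r.t. M): for each row index t with
-- M[t] ≠ M'[t] there is an edge from M[t] to M'[t] (self-loops omitted).
-- Edge t is an out-edge of τ / an in-edge of τ:
OutEdge : ∀ {d m n} → Matrix d m n → Matrix d m n → RowType d n → Fin m → Set
OutEdge M M' τ t = M t ≡ τ × M' t ≢ M t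

InEdge : ∀ {d m n} → Matrix d m n → Matrix d m n → RowType d n → Fin m → Set
InEdge M M' τ t = M' t ≡ τ × M' t ≢ M t

NoOutEdges : ∀ {d m n} → Matrix d m n → Matrix d m n → RowType d n → Set
NoOutEdges {m = m} M M' τ = (t : Fin m) → ¬ OutEdge M M' τ t

NoInEdges : ∀ {d m n} → Matrix d m n → Matrix d m n → RowType d n → Set
NoInEdges {m = m} M M' τ = (t : Fin m) → ¬ InEdge M M' τ t

module Submission where

-- Take a solution that changes as few rows of M as possible. Suppose a row s leaves the type
-- τ = M[s] and a row t of the same colour enters it. Exchanging rows s and t of the solution keeps
-- it fair (colours are preserved) and keeps its set of rows; row s becomes unchanged and row t
-- pays d(M[t], M'[s]) ≤ d(M[t], τ) + d(τ, M'[s]), so the edit cost does not grow while fewer rows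
-- are changed. Hence the minimal solution has no such pair. If an M-fair type τ had both an
-- out-edge and an in-edge, compare the rows of type τ in M with the cluster of τ in the solution:
-- both are fair, so the smaller one is outnumbered in every colour, in particular in the colour of
-- a row of it that the other misses, and this produces a same-coloured pair as above.

open import Defs
open import Data.Bool using (if_then_else_)
open import Data.Fin using (Fin; zero; suc; _≟_)
open import Data.Fin.Permutation using (Permutation; _⟨$⟩ʳ_; _⟨$⟩ˡ_; inverseʳ)
import Data.Fin.Permutation as Perm
open import Data.Fin.Permutation.Components using (transpose)
open import Data.Fin.Properties using (any?; nonZeroIndex)
open import Data.List using (filter; tabulate; map; allFin; length)
open import Data.List.Properties using (filter-≐; filter-none; map-tabulate)
open import Data.List.Membership.Propositional using (_∈_)
open import Data.List.Membership.Propositional.Properties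
  using (∈-allFin; ∈-map⁺; ∈-map⁻; ∈-filter⁺; ∈-filter⁻; ∈-deduplicate⁺; ∈-deduplicate⁻)
open import Data.List.Membership.Propositional.Properties.WithK using (unique∧set⇒bag)
open import Data.List.Relation.Binary.BagAndSetEquality using (∼bag⇒↭)
open import Data.List.Relation.Binary.Permutation.Propositional.Properties using (↭-length)
open import Data.List.Relation.Binary.Pointwise using (Pointwise-≡⇒≡)
import Data.List.Relation.Binary.Sublist.Propositional as Sublist
open import Data.List.Relation.Binary.Sublist.Propositional.Properties using (filter⁺; length-mono-≤; to-≋)
import Data.List.Relation.Unary.All as All
open import Data.List.Relation.Unary.Unique.DecPropositional.Properties using (deduplicate-!)
open import Data.Nat using (ℕ; zero; suc; _+_; _*_; _≤_; _<_; z≤n; s≤s)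
open import Data.Nat.Induction using (<-wellFounded)
open import Data.Nat.ListAction using (sum)
open import Data.Nat.Properties
  using (+-0-commutativeMonoid; +-identityʳ; +-mono-≤; +-monoˡ-≤; +-cancelʳ-≤; *-monoʳ-≤; *-cancelʳ-≤;
         ≤-reflexive; ≤-trans; ≤-total; m≤n+m; ≤∧≢⇒<; <⇒≱; module ≤-Reasoning)
open import Data.Product using (Σ; ∃-syntax; ∃₂; _×_; _,_; proj₁; proj₂)
open import Data.Sum using (_⊎_; inj₁; inj₂; [_,_])
open import Function using (_∘_; id; _⇔_; mk⇔; Equivalence)
open import Data.Vec using (lookup)
open import Induction.WellFounded using (Acc; acc)
open import Level using (0ℓ)
open import Relation.Binary.PropositionalEquality hiding ([_])
open import Relation.Nullary using (¬_; Dec; yes; no; does; contradiction)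
open import Relation.Nullary.Decidable using (_×-dec_; ¬?; decidable-stable)
open import Relation.Unary using (Pred; Decidable; _⊆_; _∪_; _≐_; Empty)
open import Algebra.Properties.CommutativeMonoid.Sum +-0-commutativeMonoid
  using (sum-permute; sum-replicate-zero; ∑-distrib-+) renaming (sum to ∑)

private
  variable
    m : ℕ
    P Q R : Pred (Fin m) 0ℓ

𝟙 : ∀ {p} {P : Set p} → Dec P → ℕ
𝟙 (yes _) = 1
𝟙 (no _)  = 0

𝟙-∪ : ∀ {A B C : Set} (A? : Dec A) (B? : Dec B) (C? : Dec C) → (A → B ⊎ C) → 𝟙 A? ≤ 𝟙 B? + 𝟙 C?
𝟙-∪ (no _)  _       _       _ = z≤n
𝟙-∪ (yes _) (yes _) _       _ = s≤s z≤n
𝟙-∪ (yes _) (no _)  (yes _) _ = s≤s z≤n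
𝟙-∪ (yes a) (no ¬b) (no ¬c) h = contradiction (h a) [ ¬b , ¬c ]

∑-mono-≤ : {f g : Fin m → ℕ} → (∀ u → f u ≤ g u) → ∑ f ≤ ∑ g
∑-mono-≤ {zero}  _   = z≤n
∑-mono-≤ {suc m} f≤g = +-mono-≤ (f≤g zero) (∑-mono-≤ (f≤g ∘ suc))

pointMass : Fin m → ℕ → Fin m → ℕ
pointMass t c u = if does (u ≟ t) then c else 0

∑-pointMass : (t : Fin m) (c : ℕ) → ∑ (pointMass t c) ≡ c
∑-pointMass {suc m} zero    c = trans (cong (c +_) (sum-replicate-zero m)) (+-identityʳ c)
∑-pointMass {suc m} (suc t) c = ∑-pointMass t c

∑-transfer-≤ : (f g : Fin m → ℕ) {s t : Fin m} → g s ≡ 0 → g t ≤ f t + f s →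
  (∀ u → u ≢ s → u ≢ t → g u ≤ f u) → ∑ g ≤ ∑ f
∑-transfer-≤ f g {s} {t} gs≡0 gt≤ft+fs g≤f = +-cancelʳ-≤ (f s) (∑ g) (∑ f) (begin
  ∑ g + f s                             ≡⟨ cong (∑ g +_) (∑-pointMass s (f s)) ⟨
  ∑ g + ∑ (pointMass s (f s))           ≡⟨ ∑-distrib-+ g (pointMass s (f s)) ⟨
  ∑ (λ u → g u + pointMass s (f s) u)   ≤⟨ ∑-mono-≤ pointwise ⟩
  ∑ (λ u → f u + pointMass t (f s) u)   ≡⟨ ∑-distrib-+ f (pointMass t (f s)) ⟩
  ∑ f + ∑ (pointMass t (f s))           ≡⟨ cong (∑ f +_) (∑-pointMass t (f s)) ⟩
  ∑ f + f s                             ∎)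
  where
  open ≤-Reasoning
  pointwise : ∀ u → g u + pointMass s (f s) u ≤ f u + pointMass t (f s) u
  pointwise u with u ≟ s | u ≟ t
  ... | yes refl | yes refl = subst (λ x → x + f u ≤ f u + f u) (sym gs≡0) (m≤n+m (f u) (f u))
  ... | yes refl | no _     = subst (λ x → x + f u ≤ f u + 0) (sym gs≡0) (≤-reflexive (sym (+-identityʳ (f u))))
  ... | no _     | yes refl = subst (_≤ f u + f s) (sym (+-identityʳ (g u))) gt≤ft+fs
  ... | no u≢s   | no u≢t   = +-monoˡ-≤ 0 (g≤f u u≢s u≢t)

sum-tabulate : (f : Fin m → ℕ) → sum (tabulate f) ≡ ∑ f
sum-tabulate {zero}  f = refl
sum-tabulate {suc m} f = cong (f zero +_) (sum-tabulate (f ∘ suc))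

sum-map-allFin : (f : Fin m → ℕ) → sum (map f (allFin m)) ≡ ∑ f
sum-map-allFin f = trans (cong sum (map-tabulate id f)) (sum-tabulate f)

length-filter-tabulate : ∀ {a} {A : Set a} {P : Pred A 0ℓ} (P? : Decidable P) (g : Fin m → A) →
  length (filter P? (tabulate g)) ≡ ∑ (λ u → 𝟙 (P? (g u)))
length-filter-tabulate {m = zero}  P? g = refl
length-filter-tabulate {m = suc m} P? g with P? (g zero)
... | yes _ = cong suc (length-filter-tabulate P? (g ∘ suc))
... | no _  = length-filter-tabulate P? (g ∘ suc)

count≡∑𝟙 : (P? : Decidable P) → count P? ≡ ∑ (𝟙 ∘ P?)
count≡∑𝟙 P? = length-filter-tabulate P? id

count-≐ : (P? : Decidable P) (Q? : Decidable Q) → P ≐ Q → count P? ≡ count Q?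
count-≐ P? Q? P≐Q = cong length (filter-≐ P? Q? P≐Q (allFin _))

count-mono-< : (P? : Decidable P) (Q? : Decidable Q) → P ⊆ Q → ∀ {x} → Q x → ¬ P x → count P? < count Q?
count-mono-< P? Q? P⊆Q {x} Qx ¬Px = ≤∧≢⇒< (length-mono-≤ P⊆Q-filtered) λ same-count →
  let same-filtered = Pointwise-≡⇒≡ (to-≋ same-count P⊆Q-filtered)
      x∈filtered    = subst (x ∈_) (sym same-filtered) (∈-filter⁺ Q? (∈-allFin x) Qx)
  in ¬Px (proj₂ (∈-filter⁻ P? {xs = allFin _} x∈filtered))
  where
  P⊆Q-filtered : filter P? (allFin _) Sublist.⊆ filter Q? (allFin _)
  P⊆Q-filtered = filter⁺ P? Q? {as = allFin _} (λ { refl → P⊆Q }) Sublist.⊆-refl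

count-≤-exchange : (P? : Decidable P) (Q? : Decidable Q) →
  count P? ≤ count Q? → ∀ {x} → P x → ¬ Q x → ∃[ y ] Q y × ¬ P y
count-≤-exchange P? Q? P≤Q Px ¬Qx with any? (λ y → Q? y ×-dec ¬? (P? y))
... | yes witness = witness
... | no ∄y = contradiction P≤Q (<⇒≱ (count-mono-< Q? P? Q⊆P Px ¬Qx))
  where
  Q⊆P : _ ⊆ _
  Q⊆P {y} Qy = decidable-stable (P? y) (λ ¬Py → ∄y (y , Qy , ¬Py))

count-∘-permutation : (P? : Decidable P) (π : Permutation m m) →
  count (λ u → P? (π ⟨$⟩ʳ u)) ≡ count P?
count-∘-permutation P? π = begin
  count (λ u → P? (π ⟨$⟩ʳ u))   ≡⟨ count≡∑𝟙 (λ u → P? (π ⟨$⟩ʳ u)) ⟩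
  ∑ (λ u → 𝟙 (P? (π ⟨$⟩ʳ u)))   ≡⟨ sum-permute (𝟙 ∘ P?) π ⟨
  ∑ (𝟙 ∘ P?)                    ≡⟨ count≡∑𝟙 P? ⟨
  count P?                      ∎
  where open ≡-Reasoning

count-≤-∪ : (P? : Decidable P) (Q? : Decidable Q) (R? : Decidable R) →
  P ⊆ Q ∪ R → count P? ≤ count Q? + count R?
count-≤-∪ P? Q? R? P⊆Q∪R = begin
  count P?                             ≡⟨ count≡∑𝟙 P? ⟩
  ∑ (𝟙 ∘ P?)                           ≤⟨ ∑-mono-≤ (λ u → 𝟙-∪ (P? u) (Q? u) (R? u) P⊆Q∪R) ⟩
  ∑ (λ u → 𝟙 (Q? u) + 𝟙 (R? u))        ≡⟨ ∑-distrib-+ (𝟙 ∘ Q?) (𝟙 ∘ R?) ⟩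
  ∑ (𝟙 ∘ Q?) + ∑ (𝟙 ∘ R?)              ≡⟨ cong₂ _+_ (count≡∑𝟙 Q?) (count≡∑𝟙 R?) ⟨
  count Q? + count R?                  ∎
  where open ≤-Reasoning

Empty⇒count≡0 : (P? : Decidable P) → Empty P → count P? ≡ 0
Empty⇒count≡0 P? ∅ = cong length (filter-none P? (All.universal ∅ (allFin _)))

transpose-matchˡ : (i j : Fin m) → transpose i j i ≡ j
transpose-matchˡ i j with i ≟ i
... | yes _   = refl
... | no i≢i = contradiction refl i≢i

transpose-matchʳ : (i j : Fin m) → transpose i j j ≡ i
transpose-matchʳ i j with j ≟ i
... | yes j≡i = j≡i
... | no _ with j ≟ j
...   | yes _   = refl
...   | no j≢j = contradiction refl j≢j

transpose-noMatch : {i j k : Fin m} → k ≢ i → k ≢ j → transpose i j k ≡ k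
transpose-noMatch {i = i} {j} {k} k≢i k≢j with k ≟ i
... | yes k≡i = contradiction k≡i k≢i
... | no _ with k ≟ j
...   | yes k≡j = contradiction k≡j k≢j
...   | no _    = refl

transpose-preserves : ∀ {B : Set} (f : Fin m → B) {i j : Fin m} → f i ≡ f j → ∀ k → f (transpose i j k) ≡ f k
transpose-preserves f {i} {j} fi≡fj k = by-cases (k ≟ i) (k ≟ j)
  where
  by-cases : Dec (k ≡ i) → Dec (k ≡ j) → f (transpose i j k) ≡ f k
  by-cases (yes refl) _          = trans (cong f (transpose-matchˡ k j)) (sym fi≡fj)
  by-cases (no _)     (yes refl) = trans (cong f (transpose-matchʳ i k)) fi≡fj
  by-cases (no k≢i)   (no k≢j)   = cong f (transpose-noMatch k≢i k≢j)

module _ {d n : ℕ} where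

  hamming-refl : (a : RowType d n) → hamming a a ≡ 0
  hamming-refl a = Empty⇒count≡0 (λ j → ¬? (lookup a j ≟ lookup a j)) (λ _ a≢a → a≢a refl)

  hamming-triangle : (a b e : RowType d n) → hamming a e ≤ hamming a b + hamming b e
  hamming-triangle a b e = count-≤-∪ _ _ _ λ {j} a≢e → case-split j a≢e
    where
    case-split : ∀ j → lookup a j ≢ lookup e j → lookup a j ≢ lookup b j ⊎ lookup b j ≢ lookup e j
    case-split j a≢e with lookup a j ≟ lookup b j
    ... | yes a≡b = inj₂ (λ b≡e → a≢e (trans a≡b b≡e))
    ... | no a≢b  = inj₁ a≢b

module _ {d m n : ℕ} where

  editDistance≡∑ : (M N : Matrix d m n) → editDistance M N ≡ ∑ (λ u → hamming (M u) (N u))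
  editDistance≡∑ M N = sum-map-allFin (λ u → hamming (M u) (N u))

  distinctRows-cong : (M N : Matrix d m n) → (∀ {τ} → τ ∈ map M (allFin m) ⇔ τ ∈ map N (allFin m)) →
    distinctRows M ≡ distinctRows N
  distinctRows-cong M N same-rows = ↭-length (∼bag⇒↭ (unique∧set⇒bag
    (deduplicate-! _≟T_ (map M (allFin m))) (deduplicate-! _≟T_ (map N (allFin m)))
    (mk⇔ (∈-deduplicate⁺ _≟T_ ∘ to same-rows ∘ ∈-deduplicate⁻ _≟T_ (map M (allFin m)))
         (∈-deduplicate⁺ _≟T_ ∘ from same-rows ∘ ∈-deduplicate⁻ _≟T_ (map N (allFin m))))))
    where open Equivalence

  row∈rows : (M : Matrix d m n) (u : Fin m) → M u ∈ map M (allFin m)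
  row∈rows M u = ∈-map⁺ M (∈-allFin u)

  distinctRows-∘-permutation : (M : Matrix d m n) (π : Permutation m m) →
    distinctRows (λ u → M (π ⟨$⟩ʳ u)) ≡ distinctRows M
  distinctRows-∘-permutation M π = distinctRows-cong _ M (mk⇔ to from)
    where
    to : ∀ {τ} → τ ∈ map (λ u → M (π ⟨$⟩ʳ u)) (allFin m) → τ ∈ map M (allFin m)
    to τ∈ with u , _ , refl ← ∈-map⁻ _ τ∈ = row∈rows M (π ⟨$⟩ʳ u)
    from : ∀ {τ} → τ ∈ map M (allFin m) → τ ∈ map (λ u → M (π ⟨$⟩ʳ u)) (allFin m)
    from τ∈ with v , _ , refl ← ∈-map⁻ _ τ∈ =
      subst (_∈ map (λ u → M (π ⟨$⟩ʳ u)) (allFin m)) (cong M (inverseʳ π))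
            (row∈rows (λ u → M (π ⟨$⟩ʳ u)) (π ⟨$⟩ˡ v))

module _ {c m : ℕ} (γ : Coloring c m) where

  FairMatrix-∘-permutation : ∀ {d n} {M : Matrix d m n} (π : Permutation m m) → (∀ u → γ (π ⟨$⟩ʳ u) ≡ γ u) →
    FairMatrix γ M → FairMatrix γ (λ u → M (π ⟨$⟩ʳ u))
  FairMatrix-∘-permutation {M = M} π γ∘π≡γ fair t i = begin
    count (λ u → (M (π ⟨$⟩ʳ u) ≟T τ) ×-dec (γ u ≟ i)) * m            ≡⟨ cong (_* m) (count-≐ _ _ recolour) ⟩
    count (λ u → (M (π ⟨$⟩ʳ u) ≟T τ) ×-dec (γ (π ⟨$⟩ʳ u) ≟ i)) * m   ≡⟨ cong (_* m) (count-∘-permutation cluster∩colour π) ⟩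
    count cluster∩colour * m                                         ≡⟨ fair (π ⟨$⟩ʳ t) i ⟩
    colorCount γ i * count (λ v → M v ≟T τ)                           ≡⟨ cong (colorCount γ i *_) (count-∘-permutation (λ v → M v ≟T τ) π) ⟨
    colorCount γ i * count (λ u → M (π ⟨$⟩ʳ u) ≟T τ)                  ∎
    where
    open ≡-Reasoning
    τ = M (π ⟨$⟩ʳ t)
    cluster∩colour : Decidable (λ v → M v ≡ τ × γ v ≡ i)
    cluster∩colour v = (M v ≟T τ) ×-dec (γ v ≟ i)
    recolour : (λ u → M (π ⟨$⟩ʳ u) ≡ τ × γ u ≡ i) ≐ (λ u → M (π ⟨$⟩ʳ u) ≡ τ × γ (π ⟨$⟩ʳ u) ≡ i)
    recolour = (λ {u} (in-cluster , γu≡i) → in-cluster , trans (γ∘π≡γ u) γu≡i)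
             , (λ {u} (in-cluster , γπu≡i) → in-cluster , trans (sym (γ∘π≡γ u)) γπu≡i)

  fair-exchange : {X Y : Pred (Fin m) 0ℓ} (X? : Decidable X) (Y? : Decidable Y) → Fair γ X? → Fair γ Y? →
    count X? ≤ count Y? → ∀ {x} → X x → ¬ Y x → ∃[ y ] Y y × ¬ X y × γ y ≡ γ x
  fair-exchange X? Y? fairX fairY X≤Y {x} Xx ¬Yx =
    let y , (Yy , γy≡γx) , ¬X∩colour =
          count-≤-exchange (in-colour X?) (in-colour Y?) X∩colour≤Y∩colour (Xx , refl) (¬Yx ∘ proj₁)
    in y , Yy , (λ Xy → ¬X∩colour (Xy , γy≡γx)) , γy≡γx
    where
    in-colour : {Z : Pred (Fin m) 0ℓ} → Decidable Z → Decidable (λ u → Z u × γ u ≡ γ x)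
    in-colour Z? u = Z? u ×-dec (γ u ≟ γ x)
    X∩colour≤Y∩colour : count (in-colour X?) ≤ count (in-colour Y?)
    X∩colour≤Y∩colour = *-cancelʳ-≤ _ _ m {{nonZeroIndex x}} (begin
      count (in-colour X?) * m          ≡⟨ fairX (γ x) ⟩
      colorCount γ (γ x) * count X?     ≤⟨ *-monoʳ-≤ (colorCount γ (γ x)) X≤Y ⟩
      colorCount γ (γ x) * count Y?     ≡⟨ fairY (γ x) ⟨
      count (in-colour Y?) * m          ∎)
      where open ≤-Reasoning

module _ {c d m n : ℕ} (M : Matrix d m n) (γ : Coloring c m) where

  changedRows : Matrix d m n → ℕ
  changedRows M′ = count (λ u → ¬? (M′ u ≟T M u))

  Swappable : Matrix d m n → Fin m → Fin m → Set
  Swappable M′ s t = OutEdge M M′ (M s) s × InEdge M M′ (M s) t × γ s ≡ γ t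

  swappable? : (M′ : Matrix d m n) (s t : Fin m) → Dec (Swappable M′ s t)
  swappable? M′ s t = ((M s ≟T M s) ×-dec ¬? (M′ s ≟T M s))
                ×-dec (((M′ t ≟T M s) ×-dec ¬? (M′ t ≟T M t)) ×-dec (γ s ≟ γ t))

  edges⇒swappable : ∀ {M′ τ s t} → OutEdge M M′ τ s → InEdge M M′ τ t → γ s ≡ γ t → Swappable M′ s t
  edges⇒swappable (refl , s-moves) t-enters γs≡γt = (refl , s-moves) , t-enters , γs≡γt

  module _ {M′ : Matrix d m n} {s t : Fin m} (swappable : Swappable M′ s t) where

    private
      M′s≢Ms = proj₂ (proj₁ swappable)
      M′t≡Ms = proj₁ (proj₁ (proj₂ swappable))
      M′t≢Mt = proj₂ (proj₁ (proj₂ swappable))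
      γs≡γt  = proj₂ (proj₂ swappable)

    swapRows : Matrix d m n
    swapRows u = M′ (Perm.transpose s t ⟨$⟩ʳ u)

    swapRows-s : swapRows s ≡ M s
    swapRows-s = trans (cong M′ (transpose-matchˡ s t)) M′t≡Ms

    swapRows-t : swapRows t ≡ M′ s
    swapRows-t = cong M′ (transpose-matchʳ s t)

    swapRows-other : ∀ {u} → u ≢ s → u ≢ t → swapRows u ≡ M′ u
    swapRows-other u≢s u≢t = cong M′ (transpose-noMatch u≢s u≢t)

    swapRows-changedRows : changedRows swapRows < changedRows M′
    swapRows-changedRows =
      count-mono-< _ _ (λ {u} → swapped-changed⇒changed (u ≟ s) (u ≟ t)) M′s≢Ms (λ changed → changed swapRows-s)
      where
      swapped-changed⇒changed : ∀ {u} → Dec (u ≡ s) → Dec (u ≡ t) → swapRows u ≢ M u → M′ u ≢ M u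
      swapped-changed⇒changed (yes refl) _          changed = contradiction swapRows-s changed
      swapped-changed⇒changed (no _)     (yes refl) _       = M′t≢Mt
      swapped-changed⇒changed (no u≢s)   (no u≢t)   changed = changed ∘ trans (swapRows-other u≢s u≢t)

    swapRows-editDistance : editDistance M swapRows ≤ editDistance M M′
    swapRows-editDistance = begin
      editDistance M swapRows  ≡⟨ editDistance≡∑ M swapRows ⟩
      ∑ cost′                  ≤⟨ ∑-transfer-≤ cost cost′ cost′-s cost′-t cost′-other ⟩
      ∑ cost                   ≡⟨ editDistance≡∑ M M′ ⟨
      editDistance M M′        ∎
      where
      open ≤-Reasoning
      cost cost′ : Fin m → ℕ
      cost  u = hamming (M u) (M′ u)
      cost′ u = hamming (M u) (swapRows u)
      cost′-s : cost′ s ≡ 0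
      cost′-s = trans (cong (hamming (M s)) swapRows-s) (hamming-refl (M s))
      cost′-t : cost′ t ≤ cost t + cost s
      cost′-t = begin
        hamming (M t) (swapRows t)                  ≡⟨ cong (hamming (M t)) swapRows-t ⟩
        hamming (M t) (M′ s)                        ≤⟨ hamming-triangle (M t) (M s) (M′ s) ⟩
        hamming (M t) (M s) + hamming (M s) (M′ s)  ≡⟨ cong (λ τ → hamming (M t) τ + cost s) M′t≡Ms ⟨
        cost t + cost s                             ∎
      cost′-other : ∀ u → u ≢ s → u ≢ t → cost′ u ≤ cost u
      cost′-other u u≢s u≢t = ≤-reflexive (cong (hamming (M u)) (swapRows-other u≢s u≢t))

    swapRows-solution : ∀ {k r} → Solution M γ k r M′ → Solution M γ k r swapRows
    swapRows-solution (fair , edit≤k , distinct≤r) =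
        FairMatrix-∘-permutation γ (Perm.transpose s t) (transpose-preserves γ γs≡γt) fair
      , ≤-trans swapRows-editDistance edit≤k
      , ≤-trans (≤-reflexive (distinctRows-∘-permutation M′ (Perm.transpose s t))) distinct≤r

  FairTypesOneSided : Matrix d m n → Set
  FairTypesOneSided M′ = (τ : RowType d n) → MFairType M γ τ → NoOutEdges M M′ τ ⊎ NoInEdges M M′ τ

  in-and-out⇒swappable : ∀ {M′ τ s t} → FairMatrix γ M′ → MFairType M γ τ →
    OutEdge M M′ τ s → InEdge M M′ τ t → ∃₂ (Swappable M′)
  in-and-out⇒swappable _ (inj₁ no-rows) (Ms≡τ , _) _ = contradiction Ms≡τ (no-rows _)
  in-and-out⇒swappable {M′} {s = s} {t} fair (inj₂ fair-τ) s-leaves@(Ms≡τ , M′s≢Ms) t-enters@(refl , M′t≢Mt)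
    with ≤-total (count (λ u → M u ≟T M′ t)) (count (λ u → M′ u ≟T M′ t))
  ... | inj₁ rows≤cluster =
    let y , M′y≡τ , My≢τ , γy≡γs =
          fair-exchange γ _ _ fair-τ (fair t) rows≤cluster Ms≡τ (λ M′s≡τ → M′s≢Ms (trans M′s≡τ (sym Ms≡τ)))
    in s , y , edges⇒swappable {M′} s-leaves (M′y≡τ , λ M′y≡My → My≢τ (trans (sym M′y≡My) M′y≡τ)) (sym γy≡γs)
  ... | inj₂ cluster≤rows =
    let y , My≡τ , M′y≢τ , γy≡γt = fair-exchange γ _ _ (fair t) fair-τ cluster≤rows refl (M′t≢Mt ∘ sym)
    in y , t , edges⇒swappable {M′} (My≡τ , λ M′y≡My → M′y≢τ (trans M′y≡My My≡τ)) t-enters γy≡γt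

  unswappable⇒oneSided : ∀ {M′} → FairMatrix γ M′ → (∀ s t → ¬ Swappable M′ s t) → FairTypesOneSided M′
  unswappable⇒oneSided {M′} fair unswappable τ τ-fair with any? (λ s → (M s ≟T τ) ×-dec ¬? (M′ s ≟T M s))
  ... | no ∄out-edge       = inj₁ (λ s out-edge → ∄out-edge (s , out-edge))
  ... | yes (s , out-edge) = inj₂ λ t in-edge →
    let s′ , t′ , swappable = in-and-out⇒swappable fair τ-fair out-edge in-edge in unswappable s′ t′ swappable

  oneSided-solution : ∀ {k r} (M′ : Matrix d m n) → Acc _<_ (changedRows M′) → Solution M γ k r M′ →
    Σ (Matrix d m n) (λ M* → Solution M γ k r M* × FairTypesOneSided M*)
  oneSided-solution M′ (acc smaller) solution with any? (λ s → any? (λ t → swappable? M′ s t))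
  ... | yes (s , t , swappable) =
    oneSided-solution (swapRows swappable) (smaller (swapRows-changedRows swappable)) (swapRows-solution swappable solution)
  ... | no ∄swappable =
    M′ , solution , unswappable⇒oneSided (proj₁ solution) (λ s t swappable → ∄swappable (s , t , swappable))

lemma10 : (c d m n : ℕ) (M : Matrix d m n) (γ : Coloring c m) (k r : ℕ) →
    1 ≤ k → 1 ≤ r → YesInstance M γ k r →
    Σ (Matrix d m n) (λ M* → Solution M γ k r M* ×
      ((τ : RowType d n) → MFairType M γ τ → NoOutEdges M M* τ ⊎ NoInEdges M M* τ))
lemma10 c d m n M γ k r _ _ (M′ , solution) = oneSided-solution M γ M′ (<-wellFounded _) solution
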